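{- Suppose that $M$ is loopless. Then \[ \overline{\chi}_M(q) = [\operatorname{rk}(M)]_q - \sum_{F \in \widehat{\mathcal{L}}} \overline{\chi}_{M/F}(q). \]
   Context: $M$ is a matroid on ground set $E$ with lattice of flats $\mathcal{L}$, $\widehat{\mathcal{L}}=\mathcal{L}\setminus\{E,\operatorname{cl}(\emptyset)\}$ (the non-empty proper flats when $M$ is loopless), $\overline{\chi}_N(q)=\chi_N(q)/(q-1)$ is the reduced characteristic polynomial, and $[n]_q=1+q+\dots+q^{n-1}$. -}

module Defs where

open import Data.Nat as ℕ using (ℕ; zero; suc; _∸_; _≤_; _<_)
open import Data.Integer as ℤ using (ℤ; +_; -_)
open import Data.Bool using (Bool; true; false; if_then_else_; _∧_; not)
open import Data.Fin using (Fin)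
open import Data.Fin.Subset using (Subset; _∈_; _∉_; _⊆_; _∪_; _∩_; _─_; ⁅_⁆; ∣_∣; ⊤; ⊥; inside; outside)
open import Data.Fin.Subset.Properties using (_⊆?_)
open import Data.Vec using (Vec; []; _∷_; tabulate)
open import Data.Vec.Properties using (≡-dec)
open import Data.List using (List; []; _∷_; map; filter; replicate; foldr)
open import Data.Product using (_×_)
open import Relation.Binary.PropositionalEquality using (_≡_)
open import Relation.Nullary using (¬_)
open import Relation.Nullary.Decidable using (⌊_⌋)
import Data.Bool.Properties as BoolP

record Matroid (n : ℕ) : Set where
  field
    rk       : Subset n → ℕ
    rk-bound : ∀ X → rk X ≤ ∣ X ∣
    rk-mono  : ∀ X Y → X ⊆ Y → rk X ≤ rk Y
    rk-submod : ∀ X Y → rk (X ∪ Y) ℕ.+ rk (X ∩ Y) ≤ rk X ℕ.+ rk Y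
open Matroid public

rank : ∀ {n} → Matroid n → ℕ
rank M = rk M ⊤

Loopless : ∀ {n} → Matroid n → Set
Loopless {n} M = ∀ (e : Fin n) → ¬ (rk M ⁅ e ⁆ ≡ 0)

-- Polynomials over ℤ as coefficient lists (constant term first).

Poly : Set
Poly = List ℤ

_+ᴾ_ : Poly → Poly → Poly
[] +ᴾ q = q
(a ∷ p) +ᴾ [] = a ∷ p
(a ∷ p) +ᴾ (b ∷ q) = (a ℤ.+ b) ∷ (p +ᴾ q)

monomial : ℤ → ℕ → Poly
monomial c zero = c ∷ []
monomial c (suc k) = + 0 ∷ monomial c k

sumᴾ : List Poly → Poly
sumᴾ = foldr _+ᴾ_ []

eval : Poly → ℤ → ℤ
eval p q = foldr (λ a acc → a ℤ.+ q ℤ.* acc) (+ 0) p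

-- quotient of p by (q - 1) (synthetic division; the remainder p(1) is
-- discarded, it vanishes whenever this is applied below).
-- If p = Σ aᵢ qⁱ then the quotient is Σⱼ (Σ_{i>j} aᵢ) qʲ.
divQ-1 : Poly → Poly
divQ-1 [] = []
divQ-1 (a ∷ []) = []
divQ-1 (a ∷ b ∷ p) = let r = divQ-1 (b ∷ p) in (headOr0 b r) ∷ r
  where
  headOr0 : ℤ → Poly → ℤ
  headOr0 b [] = b
  headOr0 b (c ∷ _) = b ℤ.+ c

qInt : ℕ → Poly
qInt m = replicate m (+ 1)

allSubsets : ∀ n → List (Subset n)
allSubsets zero = [] ∷ []
allSubsets (suc n) =
  Data.List._++_ (map (outside ∷_) (allSubsets n)) (map (inside ∷_) (allSubsets n))

subsetsOf : ∀ {n} → Subset n → List (Subset n)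
subsetsOf S = filter (λ X → X ⊆? S) (allSubsets _)

sign : ℕ → ℤ
sign zero = + 1
sign (suc k) = - sign k

charPolyOn : ∀ {n} → Subset n → (Subset n → ℕ) → Poly
charPolyOn S r = sumᴾ (map (λ X → monomial (sign ∣ X ∣) (r S ∸ r X)) (subsetsOf S))

charPoly : ∀ {n} → Matroid n → Poly
charPoly M = charPolyOn ⊤ (rk M)

redCharPoly : ∀ {n} → Matroid n → Poly
redCharPoly M = divQ-1 (charPoly M)

contractGround : ∀ {n} → Matroid n → Subset n → Subset n
contractGround M F = ⊤ ─ F

contractRank : ∀ {n} → Matroid n → Subset n → Subset n → ℕ
contractRank M F X = rk M (X ∪ F) ∸ rk M F

redCharPolyContr : ∀ {n} → Matroid n → Subset n → Poly
redCharPolyContr M F = divQ-1 (charPolyOn (contractGround M F) (contractRank M F))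

closure : ∀ {n} → Matroid n → Subset n → Subset n
closure M X = tabulate (λ e → if ⌊ rk M (X ∪ ⁅ e ⁆) ℕ.≟ rk M X ⌋ then inside else outside)

isFlat : ∀ {n} → Matroid n → Subset n → Bool
isFlat M F = ⌊ ≡-dec BoolP._≟_ (closure M F) F ⌋

flatsHat : ∀ {n} → Matroid n → List (Subset n)
flatsHat {n} M =
  filter (λ F → Relation.Nullary.Decidable.T? (isFlat M F
                   ∧ not ⌊ ≡-dec BoolP._≟_ F ⊤ ⌋
                   ∧ not ⌊ ≡-dec BoolP._≟_ F (closure M ⊥) ⌋))
         (allSubsets n)

-- Evaluated at q, division by q - 1 is additive and sends c·q^k to c·[k]_q, so
-- χ̄_{M/W}(q) = Σ_{X ⊆ E∖W} (-1)^{|X|} [r(E) - r(X ∪ W)]_q for every W ⊆ E.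
-- Summing over all W, the pairs (X, W) regroup by Z = X ∪ W into
-- Σ_Z [r(E) - r(Z)]_q Σ_{X ⊆ Z} (-1)^{|X|}, which is [rk M]_q.
-- The term of W vanishes when W = E, and when W is not a flat: an element
-- e ∉ W spanned by W can be toggled in X without changing r(X ∪ W).
-- Since M is loopless, cl(∅) = ∅, and the surviving terms are W = ∅, which
-- gives χ̄_M(q), and the flats in L̂.
module Submission where

open import Defs
open import Data.Nat as ℕ using (ℕ; zero; suc; _∸_; _≤_)
import Data.Nat.Properties as ℕP
open import Data.Integer using (ℤ; +_; -_; _+_; _*_; _-_)
import Data.Integer.Properties as ℤP
open import Algebra.Properties.CommutativeSemigroup ℤP.+-commutativeSemigroup using (interchange)
open import Data.Integer.Tactic.RingSolver using (solve-∀)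
open import Data.List using (List; []; _∷_; map; filter; _++_)
open import Data.Bool using (Bool; true; false; if_then_else_; _∧_; not)
import Data.Bool.Properties as BoolP
open import Data.Vec using ([]; _∷_; lookup; here; there)
open import Data.Vec.Properties using (≡-dec; []=⇒lookup; lookup⇒[]=; tabulate-cong; tabulate∘lookup)
open import Data.Fin using (Fin; zero; suc)
open import Data.Fin.Properties using (any?)
open import Data.Fin.Subset using (Subset; _∈_; _⊆_; _∪_; _∩_; _─_; ⁅_⁆; ∣_∣; ⊤; ⊥)
open import Data.Fin.Subset.Properties using (_⊆?_; _∈?_)
import Data.Fin.Subset.Properties as SP
open import Data.Sum using (inj₁; inj₂)
open import Data.Product using (_,_)
open import Data.Empty using (⊥-elim)
open import Relation.Nullary using (Dec; does; yes; no; ¬_; ¬?; _×-dec_)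
open import Relation.Nullary.Decidable using (⌊_⌋)
open import Level using (0ℓ)
open import Relation.Unary using (Pred; Decidable)
open import Relation.Binary.PropositionalEquality using (_≡_; refl; sym; trans; cong; cong₂; subst; module ≡-Reasoning)
open ≡-Reasoning

∑ : {A : Set} → List A → (A → ℤ) → ℤ
∑ [] g = + 0
∑ (x ∷ xs) g = g x + ∑ xs g

∑-cong : {A : Set} (xs : List A) {g h : A → ℤ} → (∀ x → g x ≡ h x) → ∑ xs g ≡ ∑ xs h
∑-cong [] g≗h = refl
∑-cong (x ∷ xs) g≗h = cong₂ _+_ (g≗h x) (∑-cong xs g≗h)

∑-++ : {A : Set} (xs ys : List A) (g : A → ℤ) → ∑ (xs ++ ys) g ≡ ∑ xs g + ∑ ys g
∑-++ [] ys g = sym (ℤP.+-identityˡ _)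
∑-++ (x ∷ xs) ys g rewrite ∑-++ xs ys g = sym (ℤP.+-assoc (g x) _ _)

∑-map : {A B : Set} (f : A → B) (xs : List A) (g : B → ℤ) → ∑ (map f xs) g ≡ ∑ xs (λ x → g (f x))
∑-map f [] g = refl
∑-map f (x ∷ xs) g = cong (_+_ (g (f x))) (∑-map f xs g)

∑-filter : {A : Set} {P : Pred A 0ℓ} (P? : Decidable P) (xs : List A) (g : A → ℤ) →
  ∑ (filter P? xs) g ≡ ∑ xs (λ x → if does (P? x) then g x else + 0)
∑-filter P? [] g = refl
∑-filter P? (x ∷ xs) g with does (P? x)
... | true = cong (_+_ (g x)) (∑-filter P? xs g)
... | false = trans (∑-filter P? xs g) (sym (ℤP.+-identityˡ _))

∑⊆ : ∀ {n} → Subset n → (Subset n → ℤ) → ℤ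
∑⊆ [] g = g []
∑⊆ (false ∷ S) g = ∑⊆ S (λ X → g (false ∷ X))
∑⊆ (true ∷ S) g = ∑⊆ S (λ X → g (false ∷ X)) + ∑⊆ S (λ X → g (true ∷ X))

infix 5 ∑⊆
syntax ∑⊆ S (λ X → e) = ∑[ X ⊆ S ] e

∑⊆-⊥ : ∀ n (g : Subset n → ℤ) → ∑⊆ ⊥ g ≡ g ⊥
∑⊆-⊥ zero g = refl
∑⊆-⊥ (suc n) g = ∑⊆-⊥ n _

∑⊆-cong : ∀ {n} (S : Subset n) {g h : Subset n → ℤ} → (∀ X → g X ≡ h X) → ∑⊆ S g ≡ ∑⊆ S h
∑⊆-cong [] g≗h = g≗h []
∑⊆-cong (false ∷ S) g≗h = ∑⊆-cong S (λ X → g≗h (false ∷ X))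
∑⊆-cong (true ∷ S) g≗h = cong₂ _+_ (∑⊆-cong S (λ X → g≗h (false ∷ X))) (∑⊆-cong S (λ X → g≗h (true ∷ X)))

∑⊆-zero : ∀ {n} (S : Subset n) → ∑[ X ⊆ S ] + 0 ≡ + 0
∑⊆-zero [] = refl
∑⊆-zero (false ∷ S) = ∑⊆-zero S
∑⊆-zero (true ∷ S) rewrite ∑⊆-zero S = refl

∑⊆-+ : ∀ {n} (S : Subset n) (g h : Subset n → ℤ) → ∑[ X ⊆ S ] (g X + h X) ≡ ∑⊆ S g + ∑⊆ S h
∑⊆-+ [] g h = refl
∑⊆-+ (false ∷ S) g h = ∑⊆-+ S _ _
∑⊆-+ (true ∷ S) g h
  rewrite ∑⊆-+ S (λ X → g (false ∷ X)) (λ X → h (false ∷ X)) | ∑⊆-+ S (λ X → g (true ∷ X)) (λ X → h (true ∷ X))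
  = interchange (∑⊆ S (λ X → g (false ∷ X))) (∑⊆ S (λ X → h (false ∷ X)))
                (∑⊆ S (λ X → g (true ∷ X))) (∑⊆ S (λ X → h (true ∷ X)))

∑⊆-neg : ∀ {n} (S : Subset n) (g : Subset n → ℤ) → ∑[ X ⊆ S ] - g X ≡ - ∑⊆ S g
∑⊆-neg [] g = refl
∑⊆-neg (false ∷ S) g = ∑⊆-neg S _
∑⊆-neg (true ∷ S) g rewrite ∑⊆-neg S (λ X → g (false ∷ X)) | ∑⊆-neg S (λ X → g (true ∷ X))
  = sym (ℤP.neg-distrib-+ (∑⊆ S (λ X → g (false ∷ X))) _)

∑⊆-- : ∀ {n} (S : Subset n) (g h : Subset n → ℤ) → ∑[ X ⊆ S ] (g X - h X) ≡ ∑⊆ S g - ∑⊆ S h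
∑⊆-- S g h = trans (∑⊆-+ S g (λ X → - h X)) (cong (_+_ (∑⊆ S g)) (∑⊆-neg S h))

∑-allSubsets : ∀ n (g : Subset n → ℤ) → ∑ (allSubsets n) g ≡ ∑⊆ ⊤ g
∑-allSubsets zero g = ℤP.+-identityʳ (g [])
∑-allSubsets (suc n) g = begin
  ∑ (map (false ∷_) (allSubsets n) ++ map (true ∷_) (allSubsets n)) g
    ≡⟨ ∑-++ (map (false ∷_) (allSubsets n)) _ g ⟩
  ∑ (map (false ∷_) (allSubsets n)) g + ∑ (map (true ∷_) (allSubsets n)) g
    ≡⟨ cong₂ _+_ (∑-map _ (allSubsets n) g) (∑-map _ (allSubsets n) g) ⟩
  ∑ (allSubsets n) (λ X → g (false ∷ X)) + ∑ (allSubsets n) (λ X → g (true ∷ X))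
    ≡⟨ cong₂ _+_ (∑-allSubsets n _) (∑-allSubsets n _) ⟩
  ∑⊆ (true ∷ ⊤) g
    ∎

∑⊆⊤-restrict : ∀ {n} (S : Subset n) (g : Subset n → ℤ) →
  ∑[ X ⊆ ⊤ ] (if does (X ⊆? S) then g X else + 0) ≡ ∑⊆ S g
∑⊆⊤-restrict [] g = refl
∑⊆⊤-restrict {suc n} (false ∷ S) g =
  trans (cong₂ _+_ (∑⊆⊤-restrict S (λ X → g (false ∷ X))) (∑⊆-zero (⊤ {n}))) (ℤP.+-identityʳ _)
∑⊆⊤-restrict (true ∷ S) g = cong₂ _+_ (∑⊆⊤-restrict S _) (∑⊆⊤-restrict S _)

∑-subsetsOf : ∀ {n} (S : Subset n) (g : Subset n → ℤ) → ∑ (subsetsOf S) g ≡ ∑⊆ S g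
∑-subsetsOf {n} S g = begin
  ∑ (subsetsOf S) g                                          ≡⟨ ∑-filter (_⊆? S) (allSubsets n) g ⟩
  ∑ (allSubsets n) (λ X → if does (X ⊆? S) then g X else + 0) ≡⟨ ∑-allSubsets n _ ⟩
  ∑[ X ⊆ ⊤ ] (if does (X ⊆? S) then g X else + 0)            ≡⟨ ∑⊆⊤-restrict S g ⟩
  ∑⊆ S g                                                     ∎

∑⊆⊤-at-⊥ : ∀ n (g : Subset n → ℤ) → ∑[ X ⊆ ⊤ ] (if does (≡-dec BoolP._≟_ X ⊥) then g X else + 0) ≡ g ⊥
∑⊆⊤-at-⊥ zero g = refl
∑⊆⊤-at-⊥ (suc n) g =
  trans (cong₂ _+_ (∑⊆⊤-at-⊥ n (λ X → g (false ∷ X))) (∑⊆-zero (⊤ {n}))) (ℤP.+-identityʳ (g ⊥))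

altSum : ∀ {n} → Subset n → (Subset n → ℤ) → ℤ
altSum S h = ∑[ X ⊆ S ] (sign ∣ X ∣ * h X)

altSum-cong : ∀ {n} (S : Subset n) {g h : Subset n → ℤ} → (∀ X → g X ≡ h X) → altSum S g ≡ altSum S h
altSum-cong S g≗h = ∑⊆-cong S (λ X → cong (sign ∣ X ∣ *_) (g≗h X))

altSum-inside : ∀ {n} (S : Subset n) (h : Subset (suc n) → ℤ) →
  altSum (true ∷ S) h ≡ altSum S (λ X → h (false ∷ X)) - altSum S (λ X → h (true ∷ X))
altSum-inside S h = cong (_+_ (altSum S (λ X → h (false ∷ X))))
  (trans (∑⊆-cong S (λ X → sym (ℤP.neg-distribˡ-* (sign ∣ X ∣) (h (true ∷ X))))) (∑⊆-neg S _))

-- Pairing X with X ∪ {e} cancels the sum.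
altSum-vanishes : ∀ {n} (S : Subset n) (e : Fin n) → e ∈ S → (h : Subset n → ℤ) →
  (∀ X → h (X ∪ ⁅ e ⁆) ≡ h X) → altSum S h ≡ + 0
altSum-vanishes (true ∷ S) zero here h h-invariant = begin
  altSum (true ∷ S) h
    ≡⟨ altSum-inside S h ⟩
  altSum S (λ X → h (false ∷ X)) - altSum S (λ X → h (true ∷ X))
    ≡⟨ cong (_-_ (altSum S (λ X → h (false ∷ X)))) (altSum-cong S toggle) ⟩
  altSum S (λ X → h (false ∷ X)) - altSum S (λ X → h (false ∷ X))
    ≡⟨ ℤP.+-inverseʳ (altSum S (λ X → h (false ∷ X))) ⟩
  + 0 ∎
  where
  toggle : ∀ X → h (true ∷ X) ≡ h (false ∷ X)
  toggle X = trans (cong (λ Y → h (true ∷ Y)) (sym (SP.∪-identityʳ X))) (h-invariant (false ∷ X))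
altSum-vanishes (false ∷ S) (suc e) (there e∈S) h h-invariant =
  altSum-vanishes S e e∈S _ (λ X → h-invariant (false ∷ X))
altSum-vanishes (true ∷ S) (suc e) (there e∈S) h h-invariant = begin
  altSum (true ∷ S) h
    ≡⟨ altSum-inside S h ⟩
  altSum S (λ X → h (false ∷ X)) - altSum S (λ X → h (true ∷ X))
    ≡⟨ cong₂ _-_ (altSum-vanishes S e e∈S _ (λ X → h-invariant (false ∷ X)))
                 (altSum-vanishes S e e∈S _ (λ X → h-invariant (true ∷ X))) ⟩
  + 0 ∎

-- Möbius inversion on the Boolean lattice: grouping by Z = X ∪ W leaves
-- f Z times Σ_{X ⊆ Z} (-1)^{|X|}, which is 0 unless Z = ∅.
altSum-möbius : ∀ n (f : Subset n → ℤ) → ∑[ W ⊆ ⊤ ] altSum (⊤ ─ W) (λ X → f (X ∪ W)) ≡ f ⊥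
altSum-möbius zero f = ℤP.*-identityˡ (f [])
altSum-möbius (suc n) f = begin
  (∑[ W ⊆ ⊤ ] altSum (true ∷ (⊤ ─ W)) (λ X → f (X ∪ (false ∷ W)))) + ∑⊆ ⊤ c
    ≡⟨ cong (_+ ∑⊆ ⊤ c) (∑⊆-cong (⊤ {n}) (λ W → altSum-inside (⊤ ─ W) (λ X → f (X ∪ (false ∷ W))))) ⟩
  (∑[ W ⊆ ⊤ ] a W - c W) + ∑⊆ ⊤ c
    ≡⟨ cong (_+ ∑⊆ ⊤ c) (∑⊆-- ⊤ a c) ⟩
  ∑⊆ ⊤ a - ∑⊆ ⊤ c + ∑⊆ ⊤ c
    ≡⟨ cancel (∑⊆ ⊤ a) (∑⊆ ⊤ c) ⟩
  ∑⊆ ⊤ a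
    ≡⟨ altSum-möbius n (λ Z → f (false ∷ Z)) ⟩
  f ⊥ ∎
  where
  a c : Subset n → ℤ
  a W = altSum (⊤ ─ W) (λ X → f (false ∷ (X ∪ W)))
  c W = altSum (⊤ ─ W) (λ X → f (true ∷ (X ∪ W)))
  cancel : ∀ x y → x - y + y ≡ x
  cancel = solve-∀

[_]_ : ℕ → ℤ → ℤ
[ k ] q = eval (qInt k) q

infix 8 [_]_

coeffSum : Poly → ℤ
coeffSum [] = + 0
coeffSum (a ∷ p) = a + coeffSum p

divQ-1-∷-∷ : ∀ a b p → divQ-1 (a ∷ b ∷ p) ≡ (b + coeffSum p) ∷ divQ-1 (b ∷ p)
divQ-1-∷-∷ a b [] = cong (_∷ []) (sym (ℤP.+-identityʳ b))
divQ-1-∷-∷ a b (c ∷ p) =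
  cong (λ x → (b + x) ∷ divQ-1 (b ∷ c ∷ p)) (cong head₀ (divQ-1-∷-∷ b c p))
  where
  head₀ : Poly → ℤ
  head₀ [] = + 0
  head₀ (x ∷ _) = x

coeffSum-+ᴾ : ∀ p r → coeffSum (p +ᴾ r) ≡ coeffSum p + coeffSum r
coeffSum-+ᴾ [] r = sym (ℤP.+-identityˡ _)
coeffSum-+ᴾ (a ∷ p) [] = sym (ℤP.+-identityʳ _)
coeffSum-+ᴾ (a ∷ p) (b ∷ r) rewrite coeffSum-+ᴾ p r = interchange a b (coeffSum p) (coeffSum r)

coeffSum-monomial : ∀ c k → coeffSum (monomial c k) ≡ c
coeffSum-monomial c zero = ℤP.+-identityʳ c
coeffSum-monomial c (suc k) = trans (ℤP.+-identityˡ _) (coeffSum-monomial c k)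

module _ (q : ℤ) where

  eval-divQ-1-∷ : ∀ a p → eval (divQ-1 (a ∷ p)) q ≡ coeffSum p + q * eval (divQ-1 p) q
  eval-divQ-1-∷ a [] = sym (trans (ℤP.+-identityˡ (q * + 0)) (ℤP.*-zeroʳ q))
  eval-divQ-1-∷ a (b ∷ p) = cong (λ r → eval r q) (divQ-1-∷-∷ a b p)

  eval-+ᴾ : ∀ p r → eval (p +ᴾ r) q ≡ eval p q + eval r q
  eval-+ᴾ [] r = sym (ℤP.+-identityˡ _)
  eval-+ᴾ (a ∷ p) [] = sym (ℤP.+-identityʳ _)
  eval-+ᴾ (a ∷ p) (b ∷ r) rewrite eval-+ᴾ p r = horner a b (eval p q) (eval r q) q
    where
    horner : ∀ a b x y q → a + b + q * (x + y) ≡ a + q * x + (b + q * y)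
    horner = solve-∀

  -- Synthetic division is linear whether or not the remainder vanishes.
  eval-divQ-1-+ᴾ : ∀ p r → eval (divQ-1 (p +ᴾ r)) q ≡ eval (divQ-1 p) q + eval (divQ-1 r) q
  eval-divQ-1-+ᴾ [] r = sym (ℤP.+-identityˡ _)
  eval-divQ-1-+ᴾ (a ∷ p) [] = sym (ℤP.+-identityʳ _)
  eval-divQ-1-+ᴾ (a ∷ p) (b ∷ r)
    rewrite eval-divQ-1-∷ (a + b) (p +ᴾ r) | eval-divQ-1-∷ a p | eval-divQ-1-∷ b r
          | coeffSum-+ᴾ p r | eval-divQ-1-+ᴾ p r
    = horner (coeffSum p) (coeffSum r) (eval (divQ-1 p) q) (eval (divQ-1 r) q) q
    where
    horner : ∀ x y u v q → x + y + q * (u + v) ≡ x + q * u + (y + q * v)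
    horner = solve-∀

  -- [k+1]_q = 1 + q [k]_q holds by computation.
  eval-divQ-1-monomial : ∀ c k → eval (divQ-1 (monomial c k)) q ≡ c * [ k ] q
  eval-divQ-1-monomial c zero = sym (ℤP.*-zeroʳ c)
  eval-divQ-1-monomial c (suc k)
    rewrite eval-divQ-1-∷ (+ 0) (monomial c k) | eval-divQ-1-monomial c k | coeffSum-monomial c k
    = factor c ([ k ] q) q
    where
    factor : ∀ c x q → c + q * (c * x) ≡ c * (+ 1 + q * x)
    factor = solve-∀

additive-sumᴾ : (φ : Poly → ℤ) → φ [] ≡ + 0 → (∀ p r → φ (p +ᴾ r) ≡ φ p + φ r) →
  {A : Set} (xs : List A) (g : A → Poly) → φ (sumᴾ (map g xs)) ≡ ∑ xs (λ x → φ (g x))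
additive-sumᴾ φ φ-[] φ-+ᴾ [] g = φ-[]
additive-sumᴾ φ φ-[] φ-+ᴾ (x ∷ xs) g =
  trans (φ-+ᴾ (g x) _) (cong (_+_ (φ (g x))) (additive-sumᴾ φ φ-[] φ-+ᴾ xs g))

eval-divQ-1-charPolyOn : ∀ q {n} (S : Subset n) (r : Subset n → ℕ) →
  eval (divQ-1 (charPolyOn S r)) q ≡ altSum S (λ X → [ r S ∸ r X ] q)
eval-divQ-1-charPolyOn q S r = begin
  eval (divQ-1 (sumᴾ (map term (subsetsOf S)))) q
    ≡⟨ additive-sumᴾ (λ p → eval (divQ-1 p) q) refl (eval-divQ-1-+ᴾ q) (subsetsOf S) term ⟩
  ∑ (subsetsOf S) (λ X → eval (divQ-1 (term X)) q)
    ≡⟨ ∑-cong (subsetsOf S) (λ X → eval-divQ-1-monomial q (sign ∣ X ∣) (r S ∸ r X)) ⟩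
  ∑ (subsetsOf S) (λ X → sign ∣ X ∣ * [ r S ∸ r X ] q)
    ≡⟨ ∑-subsetsOf S _ ⟩
  altSum S (λ X → [ r S ∸ r X ] q) ∎
  where
  term : Subset _ → Poly
  term X = monomial (sign ∣ X ∣) (r S ∸ r X)

[m∸o]∸[n∸o]≡m∸n : ∀ m {n o} → o ≤ n → (m ∸ o) ∸ (n ∸ o) ≡ m ∸ n
[m∸o]∸[n∸o]≡m∸n m {n} {o} o≤n = trans (ℕP.∸-+-assoc m o (n ∸ o)) (cong (m ∸_) (ℕP.m+[n∸m]≡n o≤n))

⊤─p∪p≡⊤ : ∀ {n} (p : Subset n) → (⊤ ─ p) ∪ p ≡ ⊤
⊤─p∪p≡⊤ [] = refl
⊤─p∪p≡⊤ (true ∷ p) = cong (true ∷_) (⊤─p∪p≡⊤ p)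
⊤─p∪p≡⊤ (false ∷ p) = cong (true ∷_) (⊤─p∪p≡⊤ p)

module _ {n : ℕ} (M : Matroid n) where

  rk-⊥ : rk M ⊥ ≡ 0
  rk-⊥ = ℕP.n≤0⇒n≡0 (ℕP.≤-trans (rk-bound M ⊥) (ℕP.≤-reflexive (SP.∣⊥∣≡0 n)))

  rk-∪-⁅⁆-∈ : ∀ {e} (W : Subset n) → e ∈ W → rk M (W ∪ ⁅ e ⁆) ≡ rk M W
  rk-∪-⁅⁆-∈ {e} W e∈W = ℕP.≤-antisym (rk-mono M _ _ W∪e⊆W) (rk-mono M _ _ (SP.p⊆p∪q ⁅ e ⁆))
    where
    W∪e⊆W : W ∪ ⁅ e ⁆ ⊆ W
    W∪e⊆W x∈W∪e with SP.x∈p∪q⁻ W ⁅ e ⁆ x∈W∪e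
    ... | inj₁ x∈W = x∈W
    ... | inj₂ x∈e = subst (_∈ W) (sym (SP.x∈⁅y⁆⇒x≡y e x∈e)) e∈W

  -- Submodularity applied to X ∪ W and W ∪ {e}, whose intersection contains W.
  rk-∪-spanned : ∀ W {e} → rk M (W ∪ ⁅ e ⁆) ≡ rk M W → ∀ X → rk M ((X ∪ ⁅ e ⁆) ∪ W) ≡ rk M (X ∪ W)
  rk-∪-spanned W {e} spanned X = ℕP.≤-antisym Z≤Y (rk-mono M Y Z Y⊆Z)
    where
    Y = X ∪ W
    B = W ∪ ⁅ e ⁆
    Z = (X ∪ ⁅ e ⁆) ∪ W
    Y⊆Z : Y ⊆ Z
    Y⊆Z x∈Y with SP.x∈p∪q⁻ X W x∈Y
    ... | inj₁ x∈X = SP.p⊆p∪q W (SP.p⊆p∪q ⁅ e ⁆ x∈X)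
    ... | inj₂ x∈W = SP.q⊆p∪q (X ∪ ⁅ e ⁆) W x∈W
    Z⊆Y∪B : Z ⊆ Y ∪ B
    Z⊆Y∪B x∈Z with SP.x∈p∪q⁻ (X ∪ ⁅ e ⁆) W x∈Z
    ... | inj₂ x∈W = SP.p⊆p∪q B (SP.q⊆p∪q X W x∈W)
    ... | inj₁ x∈X∪e with SP.x∈p∪q⁻ X ⁅ e ⁆ x∈X∪e
    ...   | inj₁ x∈X = SP.p⊆p∪q B (SP.p⊆p∪q W x∈X)
    ...   | inj₂ x∈e = SP.q⊆p∪q Y B (SP.q⊆p∪q W ⁅ e ⁆ x∈e)
    W⊆Y∩B : W ⊆ Y ∩ B
    W⊆Y∩B x∈W = SP.x∈p∩q⁺ (SP.q⊆p∪q X W x∈W , SP.p⊆p∪q ⁅ e ⁆ x∈W)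
    Z+W≤Y+W : rk M Z ℕ.+ rk M W ≤ rk M Y ℕ.+ rk M W
    Z+W≤Y+W = begin-≤
      rk M Z ℕ.+ rk M W             ≤⟨ ℕP.+-mono-≤ (rk-mono M _ _ Z⊆Y∪B) (rk-mono M _ _ W⊆Y∩B) ⟩
      rk M (Y ∪ B) ℕ.+ rk M (Y ∩ B) ≤⟨ rk-submod M Y B ⟩
      rk M Y ℕ.+ rk M B             ≤⟨ ℕP.≤-reflexive (cong (rk M Y ℕ.+_) spanned) ⟩
      rk M Y ℕ.+ rk M W             ∎≤
      where open ℕP.≤-Reasoning renaming (begin_ to begin-≤_; _∎ to _∎≤)
    Z≤Y : rk M Z ≤ rk M Y
    Z≤Y = ℕP.+-cancelʳ-≤ (rk M W) (rk M Z) (rk M Y) Z+W≤Y+W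

  closure-≡ : ∀ W → (∀ e → rk M (W ∪ ⁅ e ⁆) ≡ rk M W → e ∈ W) → closure M W ≡ W
  closure-≡ W spanned⇒∈ = trans (tabulate-cong agree) (tabulate∘lookup W)
    where
    agree : ∀ e → (if ⌊ rk M (W ∪ ⁅ e ⁆) ℕ.≟ rk M W ⌋ then true else false) ≡ lookup W e
    agree e with rk M (W ∪ ⁅ e ⁆) ℕ.≟ rk M W
    ... | yes spanned = sym ([]=⇒lookup (spanned⇒∈ e spanned))
    ... | no unspanned with lookup W e in e∈?W
    ...   | false = refl
    ...   | true = ⊥-elim (unspanned (rk-∪-⁅⁆-∈ W (lookup⇒[]= e W e∈?W)))

  loopless⇒closure-⊥ : Loopless M → closure M ⊥ ≡ ⊥
  loopless⇒closure-⊥ loopless = closure-≡ ⊥ λ e rk⁅e⁆≡rk⊥ →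
    ⊥-elim (loopless e (trans (cong (rk M) (sym (SP.∪-identityˡ ⁅ e ⁆))) (trans rk⁅e⁆≡rk⊥ rk-⊥)))

∧-∧-not-⌊yes⌋ : ∀ b c {A : Set} (a? : Dec A) → A → b ∧ c ∧ not ⌊ a? ⌋ ≡ false
∧-∧-not-⌊yes⌋ b c (yes _) _ = trans (cong (b ∧_) (BoolP.∧-zeroʳ c)) (BoolP.∧-zeroʳ b)
∧-∧-not-⌊yes⌋ b c (no ¬a) a = ⊥-elim (¬a a)

module _ {n : ℕ} (M : Matroid n) (q : ℤ) where

  redCharValue : Subset n → ℤ
  redCharValue W = altSum (⊤ ─ W) (λ X → [ rank M ∸ rk M (X ∪ W) ] q)

  eval-redCharPoly : eval (redCharPoly M) q ≡ redCharValue ⊥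
  eval-redCharPoly = begin
    eval (redCharPoly M) q
      ≡⟨ eval-divQ-1-charPolyOn q ⊤ (rk M) ⟩
    altSum ⊤ (λ X → [ rank M ∸ rk M X ] q)
      ≡⟨ altSum-cong ⊤ (λ X → cong (λ Y → [ rank M ∸ rk M Y ] q) (sym (SP.∪-identityʳ X))) ⟩
    altSum ⊤ (λ X → [ rank M ∸ rk M (X ∪ ⊥) ] q)
      ≡⟨ cong (λ S → altSum S (λ X → [ rank M ∸ rk M (X ∪ ⊥) ] q)) (sym (SP.p─⊥≡p ⊤)) ⟩
    redCharValue ⊥ ∎

  eval-redCharPolyContr : ∀ W → eval (redCharPolyContr M W) q ≡ redCharValue W
  eval-redCharPolyContr W =
    trans (eval-divQ-1-charPolyOn q (⊤ ─ W) (contractRank M W)) (altSum-cong (⊤ ─ W) contracted)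
    where
    contracted : ∀ X → [ contractRank M W (⊤ ─ W) ∸ contractRank M W X ] q ≡ [ rank M ∸ rk M (X ∪ W) ] q
    contracted X = cong (λ k → [ k ] q) (begin
      (rk M ((⊤ ─ W) ∪ W) ∸ rk M W) ∸ (rk M (X ∪ W) ∸ rk M W)
        ≡⟨ cong (λ Z → (rk M Z ∸ rk M W) ∸ (rk M (X ∪ W) ∸ rk M W)) (⊤─p∪p≡⊤ W) ⟩
      (rank M ∸ rk M W) ∸ (rk M (X ∪ W) ∸ rk M W)
        ≡⟨ [m∸o]∸[n∸o]≡m∸n (rank M) (rk-mono M W (X ∪ W) (SP.q⊆p∪q X W)) ⟩
      rank M ∸ rk M (X ∪ W) ∎)

  redCharValue-⊤ : redCharValue ⊤ ≡ + 0
  redCharValue-⊤ = begin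
    altSum (⊤ ─ ⊤) (λ X → [ rank M ∸ rk M (X ∪ ⊤) ] q)
      ≡⟨ cong (λ S → altSum S (λ X → [ rank M ∸ rk M (X ∪ ⊤) ] q)) (SP.p─⊤≡⊥ ⊤) ⟩
    altSum ⊥ (λ X → [ rank M ∸ rk M (X ∪ ⊤) ] q)
      ≡⟨ ∑⊆-⊥ n _ ⟩
    sign ∣ ⊥ {n} ∣ * [ rank M ∸ rk M (⊥ ∪ ⊤) ] q
      ≡⟨ cong (λ Z → sign ∣ ⊥ {n} ∣ * [ rank M ∸ rk M Z ] q) (SP.∪-identityˡ ⊤) ⟩
    sign ∣ ⊥ {n} ∣ * [ rank M ∸ rank M ] q
      ≡⟨ cong (λ k → sign ∣ ⊥ {n} ∣ * [ k ] q) (ℕP.n∸n≡0 (rank M)) ⟩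
    sign ∣ ⊥ {n} ∣ * + 0
      ≡⟨ ℤP.*-zeroʳ (sign ∣ ⊥ {n} ∣) ⟩
    + 0 ∎

  redCharValue-nonFlat : ∀ W → ¬ closure M W ≡ W → redCharValue W ≡ + 0
  redCharValue-nonFlat W nonFlat with any? (λ e → ¬? (e ∈? W) ×-dec (rk M (W ∪ ⁅ e ⁆) ℕ.≟ rk M W))
  ... | yes (e , e∉W , spanned) =
    altSum-vanishes (⊤ ─ W) e (SP.x∈p∧x∉q⇒x∈p─q SP.∈⊤ e∉W) _
      (λ X → cong (λ k → [ rank M ∸ k ] q) (rk-∪-spanned M W spanned X))
  ... | no noneSpanned = ⊥-elim (nonFlat (closure-≡ M W spanned⇒∈))
    where
    spanned⇒∈ : ∀ e → rk M (W ∪ ⁅ e ⁆) ≡ rk M W → e ∈ W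
    spanned⇒∈ e spanned with e ∈? W
    ... | yes e∈W = e∈W
    ... | no e∉W = ⊥-elim (noneSpanned (e , e∉W , spanned))

  ∑-redCharValue : ∑⊆ ⊤ redCharValue ≡ [ rank M ] q
  ∑-redCharValue =
    trans (altSum-möbius n (λ Z → [ rank M ∸ rk M Z ] q)) (cong (λ k → [ rank M ∸ k ] q) (rk-⊥ M))

  inL̂ : Subset n → Bool
  inL̂ W = isFlat M W ∧ not ⌊ ≡-dec BoolP._≟_ W ⊤ ⌋ ∧ not ⌊ ≡-dec BoolP._≟_ W (closure M ⊥) ⌋

  L̂-term ⊥-term : Subset n → ℤ
  L̂-term W = if inL̂ W then redCharValue W else + 0
  ⊥-term W = if does (≡-dec BoolP._≟_ W ⊥) then redCharValue W else + 0

  redCharValue-off-⊥ : Loopless M → ∀ W → ¬ W ≡ ⊥ → redCharValue W ≡ L̂-term W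
  redCharValue-off-⊥ loopless W W≢⊥ =
    by-cases (≡-dec BoolP._≟_ (closure M W) W) (≡-dec BoolP._≟_ W ⊤) (≡-dec BoolP._≟_ W (closure M ⊥))
    where
    by-cases : (flat? : Dec (closure M W ≡ W)) (⊤? : Dec (W ≡ ⊤)) (cl⊥? : Dec (W ≡ closure M ⊥)) →
      redCharValue W ≡ (if ⌊ flat? ⌋ ∧ not ⌊ ⊤? ⌋ ∧ not ⌊ cl⊥? ⌋ then redCharValue W else + 0)
    by-cases (no nonFlat) _ _ = redCharValue-nonFlat W nonFlat
    by-cases (yes _) (yes refl) _ = redCharValue-⊤
    by-cases (yes _) (no _) (yes W≡cl⊥) = ⊥-elim (W≢⊥ (trans W≡cl⊥ (loopless⇒closure-⊥ M loopless)))
    by-cases (yes _) (no _) (no _) = refl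

  redCharValue-split : Loopless M → ∀ W → redCharValue W ≡ L̂-term W + ⊥-term W
  redCharValue-split loopless W with ≡-dec BoolP._≟_ W ⊥
  ... | no W≢⊥ = trans (redCharValue-off-⊥ loopless W W≢⊥) (sym (ℤP.+-identityʳ _))
  ... | yes refl = begin
    redCharValue ⊥
      ≡⟨ sym (ℤP.+-identityˡ _) ⟩
    + 0 + redCharValue ⊥
      ≡⟨ cong (λ b → (if b then redCharValue ⊥ else + 0) + redCharValue ⊥) (sym ⊥∉L̂) ⟩
    L̂-term ⊥ + redCharValue ⊥ ∎
    where
    ⊥∉L̂ : inL̂ ⊥ ≡ false
    ⊥∉L̂ = ∧-∧-not-⌊yes⌋ (isFlat M ⊥) _ (≡-dec BoolP._≟_ ⊥ (closure M ⊥)) (sym (loopless⇒closure-⊥ M loopless))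

  ∑-redCharValue-split : Loopless M → ∑⊆ ⊤ L̂-term + redCharValue ⊥ ≡ [ rank M ] q
  ∑-redCharValue-split loopless = begin
    ∑⊆ ⊤ L̂-term + redCharValue ⊥
      ≡⟨ cong (_+_ (∑⊆ ⊤ L̂-term)) (sym (∑⊆⊤-at-⊥ n redCharValue)) ⟩
    ∑⊆ ⊤ L̂-term + ∑⊆ ⊤ ⊥-term
      ≡⟨ sym (∑⊆-+ ⊤ L̂-term ⊥-term) ⟩
    ∑[ W ⊆ ⊤ ] L̂-term W + ⊥-term W
      ≡⟨ sym (∑⊆-cong ⊤ (redCharValue-split loopless)) ⟩
    ∑⊆ ⊤ redCharValue
      ≡⟨ ∑-redCharValue ⟩
    [ rank M ] q ∎

  eval-∑-flatsHat : eval (sumᴾ (map (redCharPolyContr M) (flatsHat M))) q ≡ ∑⊆ ⊤ L̂-term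
  eval-∑-flatsHat = begin
    eval (sumᴾ (map (redCharPolyContr M) (flatsHat M))) q
      ≡⟨ additive-sumᴾ (λ p → eval p q) refl (eval-+ᴾ q) (flatsHat M) (redCharPolyContr M) ⟩
    ∑ (flatsHat M) (λ W → eval (redCharPolyContr M W) q)
      ≡⟨ ∑-cong (flatsHat M) eval-redCharPolyContr ⟩
    ∑ (flatsHat M) redCharValue
      ≡⟨ ∑-filter _ (allSubsets n) redCharValue ⟩
    ∑ (allSubsets n) L̂-term
      ≡⟨ ∑-allSubsets n _ ⟩
    ∑⊆ ⊤ L̂-term ∎

corollary2p1 : ∀ {n : ℕ} (M : Matroid n) → Loopless M →
    ∀ (q : ℤ) →
    eval (redCharPoly M) q
    ≡ eval (qInt (rank M)) q - eval (sumᴾ (map (redCharPolyContr M) (flatsHat M))) q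
corollary2p1 M loopless q = begin
  eval (redCharPoly M) q
    ≡⟨ eval-redCharPoly M q ⟩
  redCharValue M q ⊥
    ≡⟨ sym (x+y-x≡y L̂-part (redCharValue M q ⊥)) ⟩
  L̂-part + redCharValue M q ⊥ - L̂-part
    ≡⟨ cong (_- L̂-part) (∑-redCharValue-split M q loopless) ⟩
  [ rank M ] q - L̂-part
    ≡⟨ cong (_-_ ([ rank M ] q)) (sym (eval-∑-flatsHat M q)) ⟩
  eval (qInt (rank M)) q - eval (sumᴾ (map (redCharPolyContr M) (flatsHat M))) q ∎
  where
  L̂-part : ℤ
  L̂-part = ∑⊆ ⊤ (L̂-term M q)
  x+y-x≡y : ∀ x y → x + y - x ≡ y
  x+y-x≡y = solve-∀
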